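{- For positive integers $m,n,p,q,r$, \begin{align*} &\sum_{a=1}^{pm-r}\sum_{b=1}^{qn-r}\binom{pm+qm-a+b-1}{pm-r-a}\binom{pn+qn+a-b-1}{qn-r-b} +\sum_{a=1}^{pn-r}\sum_{b=1}^{qm-r}\binom{pn+qn-a+b-1}{pn-r-a}\binom{pm+qm+a-b-1}{qm-r-b}\\ &=\frac{2pqmn}{(p+q)(m+n)}\binom{pm+qm}{pm}\binom{pn+qn}{pn}-r\binom{(p+q)(m+n)}{pm+pn} +\sum_{k=1-r}^{r-1}(r-|k|)\binom{pm+qm}{pm-k}\binom{pn+qn}{qn-k}. \end{align*}
   Context: Binomial coefficients $\binom{N}{k}$ are $0$ when $k<0$ or $k>N\ge 0$. A sum whose upper limit is smaller than its lower limit is empty and equals $0$. -}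

module Defs where

open import Data.Nat as ℕ using (ℕ; zero; suc)
open import Data.Nat.Combinatorics using (_C_)
open import Data.Integer using (ℤ; +_; -[1+_]; _+_; _-_; _*_; ∣_∣)

-- Binomial coefficient with integer arguments:
-- choose N k = 0 if k < 0; otherwise the usual binomial (which is 0 for k > N ≥ 0).
-- (Negative N never occurs in the statement; we set it to 0.)
choose : ℤ → ℤ → ℤ
choose (+ n)    (+ k)    = + (n C k)
choose (+ n)    -[1+ _ ] = + 0
choose -[1+ _ ] _        = + 0

sumFrom : ℤ → ℕ → (ℤ → ℤ) → ℤ
sumFrom lo zero    f = + 0
sumFrom lo (suc l) f = f lo + sumFrom (lo + + 1) l f

Σ[_⋯_] : ℤ → ℤ → (ℤ → ℤ) → ℤ
Σ[ lo ⋯ hi ] f with hi - lo + + 1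
... | + len    = sumFrom lo len f
... | -[1+ _ ] = + 0

{-# OPTIONS --safe #-}
-- Write A = pm, B = qm, C = pn, D = qn, so that AD = BC, and τ(t) = C(A+B, A−t)·C(C+D, D−t) for t ∈ ℤ.
-- Counting a and b from the other ends of their ranges turns the first double sum into a grid sum
-- obeying Pascal's recurrence in two directions.  So does Σ_s (s+1)·τ(r+1+s), and the base cases
-- agree by the hockey-stick and Vandermonde identities; hence the first double sum is
-- Σ_{t>r} (t−r)·τ(t), and likewise the second is Σ_{t>r} (t−r)·τ(−t).  Now
-- Σ_{t>r} (t−r)·τ(t) = Σ_t t·τ(t) − r·Σ_t τ(t) + Σ_{t<r} (r−t)·τ(t).  The first moments telescope:
-- (A+B+C+D)·t·τ(t) = Y(t) − Y(t+1) with Y(t) = (B+t)(C+t)·τ(t), precisely because AD = BC, so each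
-- is AD·C(A+B, A)·C(C+D, C)/(A+B+C+D); by Vandermonde the zeroth moments add up to
-- C(A+B+C+D, A+C) + τ(0); and the corrections Σ_{t<r} (r−t)·τ(±t) make up the sum over k.
module Submission where

open import Relation.Binary.PropositionalEquality
  using (_≡_; refl; sym; trans; cong; cong₂; subst; module ≡-Reasoning)

module Sums where

  open import Data.Nat
  open import Data.Nat.Properties
  open import Algebra.Properties.CommutativeSemigroup +-commutativeSemigroup using (interchange)
  open import Data.Nat.Tactic.RingSolver using (solve-∀)
  open ≡-Reasoning

  ∑ : ℕ → (ℕ → ℕ) → ℕ
  ∑ zero    f = 0
  ∑ (suc n) f = f 0 + ∑ n (λ i → f (suc i))

  syntax ∑ n (λ i → f) = ∑[ i < n ] f

  ∑-cong : ∀ n {f g : ℕ → ℕ} → (∀ i → f i ≡ g i) → ∑ n f ≡ ∑ n g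
  ∑-cong zero    f≗g = refl
  ∑-cong (suc n) f≗g = cong₂ _+_ (f≗g 0) (∑-cong n (λ i → f≗g (suc i)))

  ∑-cong-< : ∀ n {f g : ℕ → ℕ} → (∀ {i} → i < n → f i ≡ g i) → ∑ n f ≡ ∑ n g
  ∑-cong-< zero    f≗g = refl
  ∑-cong-< (suc n) f≗g = cong₂ _+_ (f≗g z<s) (∑-cong-< n (λ i<n → f≗g (s<s i<n)))

  ∑-zero : ∀ n {f : ℕ → ℕ} → (∀ i → f i ≡ 0) → ∑ n f ≡ 0
  ∑-zero zero    f≗0 = refl
  ∑-zero (suc n) f≗0 = cong₂ _+_ (f≗0 0) (∑-zero n (λ i → f≗0 (suc i)))

  ∑-zeroʳ : ∀ n (w f : ℕ → ℕ) → (∀ i → f i ≡ 0) → ∑[ i < n ] (w i * f i) ≡ 0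
  ∑-zeroʳ n w f f≗0 = ∑-zero n (λ i → trans (cong (w i *_) (f≗0 i)) (*-zeroʳ (w i)))

  ∑-const : ∀ n c → ∑[ i < n ] c ≡ n * c
  ∑-const zero    c = refl
  ∑-const (suc n) c = cong (c +_) (∑-const n c)

  ∑-distrib-+ : ∀ n (f g : ℕ → ℕ) → ∑[ i < n ] (f i + g i) ≡ ∑ n f + ∑ n g
  ∑-distrib-+ zero    f g = refl
  ∑-distrib-+ (suc n) f g =
    trans (cong ((f 0 + g 0) +_) (∑-distrib-+ n (λ i → f (suc i)) (λ i → g (suc i)))) (interchange (f 0) (g 0) _ _)

  ∑-distribˡ-* : ∀ n c (f : ℕ → ℕ) → ∑[ i < n ] (c * f i) ≡ c * ∑ n f
  ∑-distribˡ-* zero    c f = sym (*-zeroʳ c)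
  ∑-distribˡ-* (suc n) c f =
    trans (cong (c * f 0 +_) (∑-distribˡ-* n c (λ i → f (suc i)))) (sym (*-distribˡ-+ c (f 0) _))

  ∑-split : ∀ m n (f : ℕ → ℕ) → ∑ (m + n) f ≡ ∑ m f + ∑[ i < n ] f (m + i)
  ∑-split zero    n f = refl
  ∑-split (suc m) n f =
    trans (cong (f 0 +_) (∑-split m n (λ i → f (suc i)))) (sym (+-assoc (f 0) _ _))

  ∑-last : ∀ n (f : ℕ → ℕ) → ∑ (suc n) f ≡ ∑ n f + f n
  ∑-last zero    f = +-identityʳ (f 0)
  ∑-last (suc n) f = trans (cong (f 0 +_) (∑-last n (λ i → f (suc i)))) (sym (+-assoc (f 0) _ _))

  ∑-reverse : ∀ n (f : ℕ → ℕ) → ∑ n f ≡ ∑[ i < n ] f (n ∸ suc i)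
  ∑-reverse zero    f = refl
  ∑-reverse (suc n) f = begin
    f 0 + ∑[ i < n ] f (suc i)
      ≡⟨ cong (f 0 +_) (∑-reverse n (λ i → f (suc i))) ⟩
    f 0 + ∑[ i < n ] f (suc (n ∸ suc i))
      ≡⟨ +-comm (f 0) _ ⟩
    ∑[ i < n ] f (suc (n ∸ suc i)) + f 0
      ≡⟨ cong₂ _+_ (∑-cong-< n (λ i<n → cong f (sym (+-∸-assoc 1 i<n)))) (cong f (sym (n∸n≡0 n))) ⟩
    ∑[ i < n ] f (n ∸ i) + f (n ∸ n)
      ≡⟨ ∑-last n (λ i → f (n ∸ i)) ⟨
    ∑[ i < suc n ] f (n ∸ i)
      ∎

  ∑-comm : ∀ m n (f : ℕ → ℕ → ℕ) → ∑[ i < m ] ∑[ j < n ] f i j ≡ ∑[ j < n ] ∑[ i < m ] f i j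
  ∑-comm zero    n f = sym (∑-zero n (λ _ → refl))
  ∑-comm (suc m) n f = trans (cong (∑[ j < n ] f 0 j +_) (∑-comm m n (λ i → f (suc i))))
                             (sym (∑-distrib-+ n (f 0) (λ j → ∑[ i < m ] f (suc i) j)))

  ∑-vanishing-tail : ∀ {m n} (f : ℕ → ℕ) → (∀ i → m ≤ i → f i ≡ 0) → m ≤ n → ∑ n f ≡ ∑ m f
  ∑-vanishing-tail {m} {n} f vanish m≤n = begin
    ∑ n f                                ≡⟨ cong (λ k → ∑ k f) (m+[n∸m]≡n m≤n) ⟨
    ∑ (m + (n ∸ m)) f                    ≡⟨ ∑-split m (n ∸ m) f ⟩
    ∑ m f + ∑[ i < n ∸ m ] f (m + i)     ≡⟨ cong (∑ m f +_) (∑-zero (n ∸ m) (λ i → vanish (m + i) (m≤m+n m i))) ⟩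
    ∑ m f + 0                            ≡⟨ +-identityʳ (∑ m f) ⟩
    ∑ m f                                ∎

  ∑-telescope : ∀ n (f Y : ℕ → ℕ) → (∀ t → f t + Y (suc t) ≡ Y t) → ∑ n f + Y n ≡ Y 0
  ∑-telescope zero    f Y step = refl
  ∑-telescope (suc n) f Y step = begin
    f 0 + ∑[ i < n ] f (suc i) + Y (suc n)
      ≡⟨ +-assoc (f 0) _ _ ⟩
    f 0 + (∑[ i < n ] f (suc i) + Y (suc n))
      ≡⟨ cong (f 0 +_) (∑-telescope n (λ i → f (suc i)) (λ i → Y (suc i)) (λ t → step (suc t))) ⟩
    f 0 + Y 1
      ≡⟨ step 0 ⟩
    Y 0
      ∎

  -- Σ_{t>r} (t−r)·T t = Σ_t t·T t − r·Σ_t T t + Σ_{t<r} (r−t)·T t, arranged without subtraction.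
  ∑-tail-moment : ∀ r b (T : ℕ → ℕ) →
                    ∑[ s < b ] (suc s * T (r + suc s)) + r * ∑ (r + suc b) T ≡ ∑[ t < r + suc b ] (t * T t) + ∑[ t < r ] ((r ∸ t) * T t)
  ∑-tail-moment r b T = begin
    P + r * ∑ (r + suc b) T
      ≡⟨ cong (λ x → P + r * x) (∑-split r (suc b) T) ⟩
    P + r * (∑ r T + H)
      ≡⟨ cong (P +_) (*-distribˡ-+ r (∑ r T) H) ⟩
    P + (r * ∑ r T + r * H)
      ≡⟨ cong (λ x → P + (x + r * H)) below ⟨
    P + ((X + Y) + r * H)
      ≡⟨ regroup P X Y (r * H) ⟩
    X + (r * H + P) + Y
      ≡⟨ cong (λ x → X + x + Y) above ⟨
    X + ∑[ u < suc b ] ((r + u) * T (r + u)) + Y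
      ≡⟨ cong (_+ Y) (∑-split r (suc b) (λ t → t * T t)) ⟨
    ∑[ t < r + suc b ] (t * T t) + Y
      ∎
    where
    P = ∑[ s < b ] (suc s * T (r + suc s))
    H = ∑[ u < suc b ] T (r + u)
    X = ∑[ t < r ] (t * T t)
    Y = ∑[ t < r ] ((r ∸ t) * T t)
    below : X + Y ≡ r * ∑ r T
    below = begin
      X + Y                                 ≡⟨ ∑-distrib-+ r (λ t → t * T t) (λ t → (r ∸ t) * T t) ⟨
      ∑[ t < r ] (t * T t + (r ∸ t) * T t)  ≡⟨ ∑-cong-< r (λ {t} t<r → trans (sym (*-distribʳ-+ (T t) t (r ∸ t)))
                                                                             (cong (_* T t) (m+[n∸m]≡n (<⇒≤ t<r)))) ⟩
      ∑[ t < r ] (r * T t)                  ≡⟨ ∑-distribˡ-* r r T ⟩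
      r * ∑ r T                             ∎
    above : ∑[ u < suc b ] ((r + u) * T (r + u)) ≡ r * H + P
    above = trans (∑-cong (suc b) (λ u → *-distribʳ-+ (T (r + u)) r u))
                  (trans (∑-distrib-+ (suc b) (λ u → r * T (r + u)) (λ u → u * T (r + u)))
                         (cong (_+ P) (∑-distribˡ-* (suc b) r (λ u → T (r + u)))))
    regroup : ∀ p x y z → p + ((x + y) + z) ≡ x + (z + p) + y
    regroup = solve-∀


module Binomial where

  open import Data.Nat
  open import Data.Nat.Properties
  open import Data.Nat.Combinatorics
  open import Data.Nat.Tactic.RingSolver using (solve-∀)
  open import Algebra.Properties.CommutativeSemigroup +-commutativeSemigroup using (x∙yz≈xz∙y)
  open Sums
  open ≡-Reasoning

  m∸n+[o+n]≡m+o : ∀ {m n} o → n ≤ m → m ∸ n + (o + n) ≡ m + o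
  m∸n+[o+n]≡m+o {m} {n} o n≤m = begin
    m ∸ n + (o + n)     ≡⟨ cong (m ∸ n +_) (+-comm o n) ⟩
    m ∸ n + (n + o)     ≡⟨ +-assoc (m ∸ n) n o ⟨
    m ∸ n + n + o       ≡⟨ cong (_+ o) (m∸n+n≡m n≤m) ⟩
    m + o               ∎

  [m+o]∸[m∸n]≡o+n : ∀ {m n} o → n ≤ m → m + o ∸ (m ∸ n) ≡ o + n
  [m+o]∸[m∸n]≡o+n {m} {n} o n≤m = begin
    m + o ∸ (m ∸ n)       ≡⟨ +-∸-comm o (m∸n≤m m n) ⟩
    m ∸ (m ∸ n) + o       ≡⟨ cong (_+ o) (m∸[m∸n]≡n n≤m) ⟩
    n + o                 ≡⟨ +-comm n o ⟩
    o + n                 ∎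

  C-pascal : ∀ n k → suc n C suc k ≡ n C k + n C suc k
  C-pascal n k = sym (nCk+nC[k+1]≡[n+1]C[k+1] n k)

  C-complement : ∀ k l {n} → k + l ≡ n → n C k ≡ n C l
  C-complement k l refl = trans (nCk≡nC[n∸k] (m≤m+n k l)) (cong ((k + l) C_) (m+n∸m≡n k l))

  C-absorb : ∀ n k → suc k * (suc n C suc k) ≡ suc n * (n C k)
  C-absorb zero    zero    = refl
  C-absorb zero    (suc k) = *-zeroʳ (suc (suc k))
  C-absorb (suc n) zero    = trans (*-identityˡ _) (trans (nC1≡n (suc (suc n))) (sym (*-identityʳ _)))
  C-absorb (suc n) (suc k) = begin
    suc (suc k) * (suc (suc n) C suc (suc k))
      ≡⟨ cong (suc (suc k) *_) (C-pascal (suc n) (suc k)) ⟩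
    suc (suc k) * (suc n C suc k + suc n C suc (suc k))
      ≡⟨ *-distribˡ-+ (suc (suc k)) (suc n C suc k) _ ⟩
    suc n C suc k + suc k * (suc n C suc k) + suc (suc k) * (suc n C suc (suc k))
      ≡⟨ cong₂ (λ x y → suc n C suc k + x + y) (C-absorb n k) (C-absorb n (suc k)) ⟩
    suc n C suc k + suc n * (n C k) + suc n * (n C suc k)
      ≡⟨ cong (λ x → x + suc n * (n C k) + suc n * (n C suc k)) (C-pascal n k) ⟩
    n C k + n C suc k + suc n * (n C k) + suc n * (n C suc k)
      ≡⟨ regroup n (n C k) (n C suc k) ⟩
    suc (suc n) * (n C k + n C suc k)
      ≡⟨ cong (suc (suc n) *_) (C-pascal n k) ⟨
    suc (suc n) * (suc n C suc k)
      ∎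
    where
    regroup : ∀ n x y → x + y + suc n * x + suc n * y ≡ suc (suc n) * (x + y)
    regroup = solve-∀

  C-ratio : ∀ n k → suc k * (n C suc k) + k * (n C k) ≡ n * (n C k)
  C-ratio zero    zero    = refl
  C-ratio zero    (suc k) = cong₂ _+_ (*-zeroʳ (suc (suc k))) (*-zeroʳ (suc k))
  C-ratio (suc n) zero    = trans (+-identityʳ _) (trans (*-identityˡ _) (trans (nC1≡n (suc n)) (sym (*-identityʳ (suc n)))))
  C-ratio (suc n) (suc k) = begin
    suc (suc k) * (suc n C suc (suc k)) + suc k * (suc n C suc k)
      ≡⟨ cong₂ _+_ (C-absorb n (suc k)) (C-absorb n k) ⟩
    suc n * (n C suc k) + suc n * (n C k)
      ≡⟨ *-distribˡ-+ (suc n) (n C suc k) (n C k) ⟨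
    suc n * (n C suc k + n C k)
      ≡⟨ cong (suc n *_) (trans (+-comm (n C suc k) (n C k)) (sym (C-pascal n k))) ⟩
    suc n * (suc n C suc k)
      ∎

  C-ratio-∸ : ∀ n k → suc k * (n C suc k) ≡ (n ∸ k) * (n C k)
  C-ratio-∸ n k = begin
    suc k * (n C suc k)                                ≡⟨ m+n∸n≡m (suc k * (n C suc k)) (k * (n C k)) ⟨
    suc k * (n C suc k) + k * (n C k) ∸ k * (n C k)    ≡⟨ cong (_∸ k * (n C k)) (C-ratio n k) ⟩
    n * (n C k) ∸ k * (n C k)                          ≡⟨ *-distribʳ-∸ (n C k) n k ⟨
    (n ∸ k) * (n C k)                                  ∎

  C-ratio-shift : ∀ a b t {n} → a + b ≡ n → suc (b + t) * (n C (b + suc t)) ≡ (a ∸ t) * (n C (b + t))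
  C-ratio-shift a b t refl = begin
    suc (b + t) * ((a + b) C (b + suc t))       ≡⟨ cong (λ k → suc (b + t) * ((a + b) C k)) (+-suc b t) ⟩
    suc (b + t) * ((a + b) C suc (b + t))       ≡⟨ C-ratio-∸ (a + b) (b + t) ⟩
    (a + b ∸ (b + t)) * ((a + b) C (b + t))     ≡⟨ cong (λ k → (k ∸ (b + t)) * ((a + b) C (b + t))) (+-comm a b) ⟩
    (b + a ∸ (b + t)) * ((a + b) C (b + t))     ≡⟨ cong (_* ((a + b) C (b + t))) ([m+n]∸[m+o]≡n∸o b a t) ⟩
    (a ∸ t) * ((a + b) C (b + t))               ∎

  hockey-stick : ∀ k m → ∑[ j < suc m ] ((k + j) C j) ≡ (suc k + m) C m
  hockey-stick k zero    = refl
  hockey-stick k (suc m) = begin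
    ∑[ j < suc (suc m) ] ((k + j) C j)
      ≡⟨ ∑-last (suc m) (λ j → (k + j) C j) ⟩
    ∑[ j < suc m ] ((k + j) C j) + (k + suc m) C suc m
      ≡⟨ cong (_+ (k + suc m) C suc m) (trans (hockey-stick k m) (cong (_C m) (sym (+-suc k m)))) ⟩
    (k + suc m) C m + (k + suc m) C suc m
      ≡⟨ C-pascal (k + suc m) m ⟨
    (suc k + suc m) C suc m
      ∎

  vandermonde : ∀ M N K → ∑[ i < suc K ] ((M C i) * (N C (K ∸ i))) ≡ (M + N) C K
  vandermonde zero    N K = trans (cong₂ _+_ (*-identityˡ (N C K)) (∑-zero K (λ _ → refl))) (+-identityʳ (N C K))
  vandermonde (suc M) N zero    = refl
  vandermonde (suc M) N (suc K) = begin
    1 * (N C suc K) + ∑[ i < suc K ] ((suc M C suc i) * y i)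
      ≡⟨ cong (1 * (N C suc K) +_) (∑-cong (suc K) (λ i → trans (cong (_* y i) (C-pascal M i)) (*-distribʳ-+ (y i) (M C i) (M C suc i)))) ⟩
    1 * (N C suc K) + ∑[ i < suc K ] ((M C i) * y i + (M C suc i) * y i)
      ≡⟨ cong (1 * (N C suc K) +_) (∑-distrib-+ (suc K) (λ i → (M C i) * y i) (λ i → (M C suc i) * y i)) ⟩
    1 * (N C suc K) + (∑[ i < suc K ] ((M C i) * y i) + ∑[ i < suc K ] ((M C suc i) * y i))
      ≡⟨ x∙yz≈xz∙y (1 * (N C suc K)) (∑[ i < suc K ] ((M C i) * y i)) _ ⟩
    ∑[ i < suc (suc K) ] ((M C i) * (N C (suc K ∸ i))) + ∑[ i < suc K ] ((M C i) * y i)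
      ≡⟨ cong₂ _+_ (vandermonde M N (suc K)) (vandermonde M N K) ⟩
    (M + N) C suc K + (M + N) C K
      ≡⟨ trans (+-comm ((M + N) C suc K) ((M + N) C K)) (sym (C-pascal (M + N) K)) ⟩
    (suc M + N) C suc K
      ∎
    where
    y : ℕ → ℕ
    y i = N C (K ∸ i)

  vandermonde-upper : ∀ a b n → ∑[ i < suc n ] (((a + i) C i) * ((b + (n ∸ i)) C (n ∸ i))) ≡ (suc (a + b) + n) C n
  vandermonde-upper zero    b n = begin
    ∑[ i < suc n ] ((i C i) * ((b + (n ∸ i)) C (n ∸ i)))
      ≡⟨ ∑-cong (suc n) (λ i → trans (cong (_* ((b + (n ∸ i)) C (n ∸ i))) (nCn≡1 i)) (*-identityˡ _)) ⟩
    ∑[ i < suc n ] ((b + (n ∸ i)) C (n ∸ i))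
      ≡⟨ ∑-reverse (suc n) (λ j → (b + j) C j) ⟨
    ∑[ j < suc n ] ((b + j) C j)
      ≡⟨ hockey-stick b n ⟩
    (suc b + n) C n
      ∎
  vandermonde-upper (suc a) b zero    = refl
  vandermonde-upper (suc a) b (suc n) = begin
    1 * y 0 + ∑[ i < suc n ] (((suc a + suc i) C suc i) * y (suc i))
      ≡⟨ cong (1 * y 0 +_) (∑-cong (suc n) (λ i → trans (cong (_* y (suc i)) (C-pascal (a + suc i) i))
                                                        (*-distribʳ-+ (y (suc i)) ((a + suc i) C i) ((a + suc i) C suc i)))) ⟩
    1 * y 0 + ∑[ i < suc n ] (((a + suc i) C i) * y (suc i) + ((a + suc i) C suc i) * y (suc i))
      ≡⟨ cong (1 * y 0 +_) (∑-distrib-+ (suc n) (λ i → ((a + suc i) C i) * y (suc i)) (λ i → ((a + suc i) C suc i) * y (suc i))) ⟩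
    1 * y 0 + (∑[ i < suc n ] (((a + suc i) C i) * y (suc i)) + ∑[ i < suc n ] (((a + suc i) C suc i) * y (suc i)))
      ≡⟨ x∙yz≈xz∙y (1 * y 0) (∑[ i < suc n ] (((a + suc i) C i) * y (suc i))) _ ⟩
    ∑[ i < suc (suc n) ] (((a + i) C i) * y i) + ∑[ i < suc n ] (((a + suc i) C i) * y (suc i))
      ≡⟨ cong (∑[ i < suc (suc n) ] (((a + i) C i) * y i) +_) (∑-cong (suc n) (λ i → cong (λ x → (x C i) * y (suc i)) (+-suc a i))) ⟩
    ∑[ i < suc (suc n) ] (((a + i) C i) * y i) + ∑[ i < suc n ] (((suc a + i) C i) * ((b + (n ∸ i)) C (n ∸ i)))
      ≡⟨ cong₂ _+_ (vandermonde-upper a b (suc n)) (vandermonde-upper (suc a) b n) ⟩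
    (suc (a + b) + suc n) C suc n + (suc (suc a + b) + n) C n
      ≡⟨ cong (λ x → (suc (a + b) + suc n) C suc n + x C n) (sym (+-suc (suc (a + b)) n)) ⟩
    (suc (a + b) + suc n) C suc n + (suc (a + b) + suc n) C n
      ≡⟨ trans (+-comm ((suc (a + b) + suc n) C suc n) _) (sym (C-pascal (suc (a + b) + suc n) n)) ⟩
    (suc (suc a + b) + suc n) C suc n
      ∎
    where
    y : ℕ → ℕ
    y i = (b + (suc n ∸ i)) C (suc n ∸ i)

module Lattice where

  open import Data.Nat
  open import Data.Nat.Properties
  open import Data.Nat.Combinatorics
  open import Algebra.Properties.CommutativeSemigroup +-commutativeSemigroup using (x∙yz≈xz∙y)
  open import Algebra.Properties.CommutativeSemigroup *-commutativeSemigroup using (x∙yz≈y∙xz)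
  open Sums
  open Binomial
  open ≡-Reasoning

  gridTerm : ℕ → ℕ → ℕ → ℕ → ℕ → ℕ → ℕ
  gridTerm U V n m i j = ((U + i + (m ∸ j)) C i) * ((V + (n ∸ i) + j) C j)

  gridTerm-split : ∀ U V α i β j → gridTerm U V (α + i) (β + j) i j ≡ ((U + i + β) C i) * ((V + α + j) C j)
  gridTerm-split U V α i β j =
    cong₂ _*_ (cong (λ x → (U + i + x) C i) (m+n∸n≡m β j)) (cong (λ x → (V + x + j) C j) (m+n∸n≡m α i))

  -- The first double sum of the theorem, counted by i = A−r−a and j = D−r−b,
  -- where U = B+r, V = C+r, A = r+1+n and D = r+1+m.
  gridSum : ℕ → ℕ → ℕ → ℕ → ℕ
  gridSum U V n m = ∑[ i < suc n ] ∑[ j < suc m ] gridTerm U V n m i j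

  -- Σ_s (s+1)·C(U+1+n, n−s)·C(V+1+m, m−s), with the lower indices complemented so that the
  -- terms with s > n or s > m vanish instead of being truncated by ∸.
  weightedSum : ℕ → ℕ → ℕ → ℕ → ℕ → ℕ
  weightedSum b U V n m = ∑[ s < b ] (suc s * (((U + suc n) C (U + suc s)) * ((V + suc m) C (V + suc s))))

  gridSum-stepU : ∀ U V n m → gridSum (suc U) V (suc n) m ≡ gridSum U V (suc n) m + gridSum (suc U) V n m
  gridSum-stepU U V n m = begin
    row + ∑[ i < suc n ] ∑[ j < suc m ] (((suc U + suc i + (m ∸ j)) C suc i) * c i j)
      ≡⟨ cong (row +_) (∑-cong (suc n) (λ i → ∑-cong (suc m) (λ j → pascal i j))) ⟩
    row + ∑[ i < suc n ] ∑[ j < suc m ] (a i j + b i j)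
      ≡⟨ cong (row +_) (trans (∑-cong (suc n) (λ i → ∑-distrib-+ (suc m) (a i) (b i)))
                               (∑-distrib-+ (suc n) (λ i → ∑ (suc m) (a i)) (λ i → ∑ (suc m) (b i)))) ⟩
    row + (∑[ i < suc n ] ∑ (suc m) (a i) + ∑[ i < suc n ] ∑ (suc m) (b i))
      ≡⟨ x∙yz≈xz∙y row (∑[ i < suc n ] ∑ (suc m) (a i)) _ ⟩
    gridSum U V (suc n) m + ∑[ i < suc n ] ∑ (suc m) (a i)
      ≡⟨ cong (gridSum U V (suc n) m +_)
              (∑-cong (suc n) (λ i → ∑-cong (suc m) (λ j → cong (λ x → ((x + (m ∸ j)) C i) * c i j) (+-suc U i)))) ⟩
    gridSum U V (suc n) m + gridSum (suc U) V n m
      ∎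
    where
    row = ∑[ j < suc m ] (1 * ((V + suc n + j) C j))
    c : ℕ → ℕ → ℕ
    c i j = (V + (n ∸ i) + j) C j
    a b : ℕ → ℕ → ℕ
    a i j = ((U + suc i + (m ∸ j)) C i) * c i j
    b i j = ((U + suc i + (m ∸ j)) C suc i) * c i j
    pascal : ∀ i j → ((suc U + suc i + (m ∸ j)) C suc i) * c i j ≡ a i j + b i j
    pascal i j = trans (cong (_* c i j) (C-pascal (U + suc i + (m ∸ j)) i))
                       (*-distribʳ-+ (c i j) ((U + suc i + (m ∸ j)) C i) ((U + suc i + (m ∸ j)) C suc i))

  gridSum-stepV : ∀ U V n m → gridSum U (suc V) n (suc m) ≡ gridSum U V n (suc m) + gridSum U (suc V) n m
  gridSum-stepV U V n m =
    trans (∑-cong (suc n) row)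
          (∑-distrib-+ (suc n) (λ i → ∑ (suc (suc m)) (gridTerm U V n (suc m) i)) (λ i → ∑ (suc m) (gridTerm U (suc V) n m i)))
    where
    row : ∀ i → ∑ (suc (suc m)) (gridTerm U (suc V) n (suc m) i)
              ≡ ∑ (suc (suc m)) (gridTerm U V n (suc m) i) + ∑ (suc m) (gridTerm U (suc V) n m i)
    row i = begin
      col + ∑[ j < suc m ] (d j * ((suc V + (n ∸ i) + suc j) C suc j))
        ≡⟨ cong (col +_) (∑-cong (suc m) pascal) ⟩
      col + ∑[ j < suc m ] (a j + b j)
        ≡⟨ cong (col +_) (∑-distrib-+ (suc m) a b) ⟩
      col + (∑ (suc m) a + ∑ (suc m) b)
        ≡⟨ x∙yz≈xz∙y col (∑ (suc m) a) _ ⟩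
      col + ∑ (suc m) b + ∑ (suc m) a
        ≡⟨ cong (col + ∑ (suc m) b +_) (∑-cong (suc m) (λ j → cong (λ x → d j * (x C j)) (+-suc (V + (n ∸ i)) j))) ⟩
      col + ∑ (suc m) b + ∑ (suc m) (gridTerm U (suc V) n m i)
        ∎
      where
      col = ((U + i + suc m) C i) * 1
      d : ℕ → ℕ
      d j = (U + i + (m ∸ j)) C i
      a b : ℕ → ℕ
      a j = d j * ((V + (n ∸ i) + suc j) C j)
      b j = d j * ((V + (n ∸ i) + suc j) C suc j)
      pascal : ∀ j → d j * ((suc V + (n ∸ i) + suc j) C suc j) ≡ a j + b j
      pascal j = trans (cong (d j *_) (C-pascal (V + (n ∸ i) + suc j) j))
                       (*-distribˡ-+ (d j) ((V + (n ∸ i) + suc j) C j) ((V + (n ∸ i) + suc j) C suc j))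

  weightedSum-stepU : ∀ b U V n m → weightedSum b (suc U) V (suc n) m ≡ weightedSum b U V (suc n) m + weightedSum b (suc U) V n m
  weightedSum-stepU b U V n m = trans (∑-cong b term) (∑-distrib-+ b f g)
    where
    y : ℕ → ℕ
    y s = (V + suc m) C (V + suc s)
    f g : ℕ → ℕ
    f s = suc s * (((U + suc (suc n)) C (U + suc s)) * y s)
    g s = suc s * (((suc U + suc n) C (suc U + suc s)) * y s)
    term : ∀ s → suc s * (((suc U + suc (suc n)) C (suc U + suc s)) * y s) ≡ f s + g s
    term s = begin
      suc s * ((suc (U + suc (suc n)) C suc (U + suc s)) * y s)
        ≡⟨ cong (λ x → suc s * (x * y s)) (C-pascal (U + suc (suc n)) (U + suc s)) ⟩
      suc s * (((U + suc (suc n)) C (U + suc s) + (U + suc (suc n)) C suc (U + suc s)) * y s)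
        ≡⟨ cong (suc s *_) (*-distribʳ-+ (y s) ((U + suc (suc n)) C (U + suc s)) _) ⟩
      suc s * (((U + suc (suc n)) C (U + suc s)) * y s + ((U + suc (suc n)) C suc (U + suc s)) * y s)
        ≡⟨ *-distribˡ-+ (suc s) (((U + suc (suc n)) C (U + suc s)) * y s) _ ⟩
      f s + suc s * (((U + suc (suc n)) C suc (U + suc s)) * y s)
        ≡⟨ cong (λ x → f s + suc s * ((x C suc (U + suc s)) * y s)) (+-suc U (suc n)) ⟩
      f s + g s
        ∎

  weightedSum-stepV : ∀ b U V n m → weightedSum b U (suc V) n (suc m) ≡ weightedSum b U V n (suc m) + weightedSum b U (suc V) n m
  weightedSum-stepV b U V n m = trans (∑-cong b term) (∑-distrib-+ b f g)
    where
    x : ℕ → ℕ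
    x s = (U + suc n) C (U + suc s)
    f g : ℕ → ℕ
    f s = suc s * (x s * ((V + suc (suc m)) C (V + suc s)))
    g s = suc s * (x s * ((suc V + suc m) C (suc V + suc s)))
    term : ∀ s → suc s * (x s * ((suc V + suc (suc m)) C (suc V + suc s))) ≡ f s + g s
    term s = begin
      suc s * (x s * (suc (V + suc (suc m)) C suc (V + suc s)))
        ≡⟨ cong (λ z → suc s * (x s * z)) (C-pascal (V + suc (suc m)) (V + suc s)) ⟩
      suc s * (x s * ((V + suc (suc m)) C (V + suc s) + (V + suc (suc m)) C suc (V + suc s)))
        ≡⟨ cong (suc s *_) (*-distribˡ-+ (x s) ((V + suc (suc m)) C (V + suc s)) _) ⟩
      suc s * (x s * ((V + suc (suc m)) C (V + suc s)) + x s * ((V + suc (suc m)) C suc (V + suc s)))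
        ≡⟨ *-distribˡ-+ (suc s) (x s * ((V + suc (suc m)) C (V + suc s))) _ ⟩
      f s + suc s * (x s * ((V + suc (suc m)) C suc (V + suc s)))
        ≡⟨ cong (λ z → f s + suc s * (x s * (z C suc (V + suc s)))) (+-suc V (suc m)) ⟩
      f s + g s
        ∎

  gridSum-n0 : ∀ U V m → gridSum U V 0 m ≡ (suc V + m) C m
  gridSum-n0 U V m = begin
    ∑[ j < suc m ] (1 * ((V + 0 + j) C j)) + 0
      ≡⟨ +-identityʳ _ ⟩
    ∑[ j < suc m ] (1 * ((V + 0 + j) C j))
      ≡⟨ ∑-cong (suc m) (λ j → trans (*-identityˡ _) (cong (λ x → (x + j) C j) (+-identityʳ V))) ⟩
    ∑[ j < suc m ] ((V + j) C j)
      ≡⟨ hockey-stick V m ⟩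
    (suc V + m) C m
      ∎

  gridSum-m0 : ∀ U V n → gridSum U V n 0 ≡ (suc U + n) C n
  gridSum-m0 U V n = begin
    ∑[ i < suc n ] (((U + i + 0) C i) * 1 + 0)
      ≡⟨ ∑-cong (suc n) (λ i → trans (+-identityʳ _) (trans (*-identityʳ _) (cong (_C i) (+-identityʳ (U + i))))) ⟩
    ∑[ i < suc n ] ((U + i) C i)
      ≡⟨ hockey-stick U n ⟩
    (suc U + n) C n
      ∎

  gridSum-00 : ∀ n m → gridSum 0 0 n m ≡ suc m * ((suc m + n) C n)
  gridSum-00 n m = begin
    ∑[ i < suc n ] ∑[ j < suc m ] gridTerm 0 0 n m i j
      ≡⟨ ∑-comm (suc n) (suc m) (gridTerm 0 0 n m) ⟩
    ∑[ j < suc m ] ∑[ i < suc n ] gridTerm 0 0 n m i j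
      ≡⟨ ∑-cong-< (suc m) column ⟩
    ∑[ j < suc m ] ((suc m + n) C n)
      ≡⟨ ∑-const (suc m) _ ⟩
    suc m * ((suc m + n) C n)
      ∎
    where
    column : ∀ {j} → j < suc m → ∑[ i < suc n ] gridTerm 0 0 n m i j ≡ (suc m + n) C n
    column {j} j<1+m = begin
      ∑[ i < suc n ] (((i + (m ∸ j)) C i) * (((n ∸ i) + j) C j))
        ≡⟨ ∑-cong (suc n) (λ i → cong₂ _*_ (cong (_C i) (+-comm i (m ∸ j)))
                                           (trans (C-complement j (n ∸ i) (+-comm j (n ∸ i))) (cong (_C (n ∸ i)) (+-comm (n ∸ i) j)))) ⟩
      ∑[ i < suc n ] ((((m ∸ j) + i) C i) * ((j + (n ∸ i)) C (n ∸ i)))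
        ≡⟨ vandermonde-upper (m ∸ j) j n ⟩
      (suc (m ∸ j + j) + n) C n
        ≡⟨ cong (λ x → (suc x + n) C n) (m∸n+n≡m (≤-pred j<1+m)) ⟩
      (suc m + n) C n
        ∎

  weightedSum-n0 : ∀ b U V m → weightedSum (suc b) U V 0 m ≡ (suc V + m) C m
  weightedSum-n0 b U V m = begin
    1 * (((U + 1) C (U + 1)) * z) + ∑[ s < b ] (suc (suc s) * (((U + 1) C (U + suc (suc s))) * ((V + suc m) C (V + suc (suc s)))))
      ≡⟨ cong₂ _+_ (trans (*-identityˡ _) (trans (cong (_* z) (nCn≡1 (U + 1))) (*-identityˡ z)))
                   (∑-zero b (λ s → trans (cong (λ x → suc (suc s) * (x * y s)) (k>n⇒nCk≡0 (+-monoʳ-< U (s<s z<s))))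
                                          (*-zeroʳ (suc (suc s))))) ⟩
    z + 0
      ≡⟨ +-identityʳ z ⟩
    (V + suc m) C (V + 1)
      ≡⟨ C-complement (V + 1) m (+-assoc V 1 m) ⟩
    (V + suc m) C m
      ≡⟨ cong (_C m) (+-suc V m) ⟩
    (suc V + m) C m
      ∎
    where
    z = (V + suc m) C (V + 1)
    y : ℕ → ℕ
    y s = (V + suc m) C (V + suc (suc s))

  weightedSum-m0 : ∀ b U V n → weightedSum (suc b) U V n 0 ≡ (suc U + n) C n
  weightedSum-m0 b U V n = begin
    1 * (z * ((V + 1) C (V + 1))) + ∑[ s < b ] (suc (suc s) * (((U + suc n) C (U + suc (suc s))) * ((V + 1) C (V + suc (suc s)))))
      ≡⟨ cong₂ _+_ (trans (*-identityˡ _) (trans (cong (z *_) (nCn≡1 (V + 1))) (*-identityʳ z)))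
                   (∑-zero b (λ s → trans (cong (λ y → suc (suc s) * (x s * y)) (k>n⇒nCk≡0 (+-monoʳ-< V (s<s z<s))))
                                          (trans (cong (suc (suc s) *_) (*-zeroʳ (x s))) (*-zeroʳ (suc (suc s)))))) ⟩
    z + 0
      ≡⟨ +-identityʳ z ⟩
    (U + suc n) C (U + 1)
      ≡⟨ C-complement (U + 1) n (+-assoc U 1 n) ⟩
    (U + suc n) C n
      ≡⟨ cong (_C n) (+-suc U n) ⟩
    (suc U + n) C n
      ∎
    where
    z = (U + suc n) C (U + 1)
    x : ℕ → ℕ
    x s = (U + suc n) C (U + suc (suc s))

  weightedSum-00 : ∀ b n m → n < b → weightedSum b 0 0 n m ≡ suc m * ((suc m + n) C n)
  weightedSum-00 b n m n<b = begin
    ∑[ s < b ] (suc s * ((suc n C suc s) * (suc m C suc s)))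
      ≡⟨ ∑-cong b absorb ⟩
    ∑[ s < b ] (suc m * ((suc n C suc s) * (m C s)))
      ≡⟨ ∑-distribˡ-* b (suc m) (λ s → (suc n C suc s) * (m C s)) ⟩
    suc m * ∑[ s < b ] ((suc n C suc s) * (m C s))
      ≡⟨ cong (suc m *_) (∑-vanishing-tail (λ s → (suc n C suc s) * (m C s)) (λ s n<s → cong (_* (m C s)) (k>n⇒nCk≡0 (s<s n<s))) n<b) ⟩
    suc m * ∑[ s < suc n ] ((suc n C suc s) * (m C s))
      ≡⟨ cong (suc m *_) (∑-cong-< (suc n) (λ {s} s<1+n → trans (*-comm (suc n C suc s) (m C s))
           (cong ((m C s) *_) (C-complement (suc s) (n ∸ s) (cong suc (m+[n∸m]≡n (≤-pred s<1+n))))))) ⟩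
    suc m * ∑[ s < suc n ] ((m C s) * (suc n C (n ∸ s)))
      ≡⟨ cong (suc m *_) (vandermonde m (suc n) n) ⟩
    suc m * ((m + suc n) C n)
      ≡⟨ cong (λ x → suc m * (x C n)) (+-suc m n) ⟩
    suc m * ((suc m + n) C n)
      ∎
    where
    absorb : ∀ s → suc s * ((suc n C suc s) * (suc m C suc s)) ≡ suc m * ((suc n C suc s) * (m C s))
    absorb s = begin
      suc s * ((suc n C suc s) * (suc m C suc s))   ≡⟨ x∙yz≈y∙xz (suc s) (suc n C suc s) _ ⟩
      (suc n C suc s) * (suc s * (suc m C suc s))   ≡⟨ cong ((suc n C suc s) *_) (C-absorb m s) ⟩
      (suc n C suc s) * (suc m * (m C s))           ≡⟨ x∙yz≈y∙xz (suc n C suc s) (suc m) _ ⟩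
      suc m * ((suc n C suc s) * (m C s))           ∎

  gridSum≡weightedSum : ∀ U V n m b → n < b → gridSum U V n m ≡ weightedSum b U V n m
  gridSum≡weightedSum U       V       zero    m       (suc b) _   = trans (gridSum-n0 U V m) (sym (weightedSum-n0 b U V m))
  gridSum≡weightedSum U       V       (suc n) zero    (suc b) _   = trans (gridSum-m0 U V (suc n)) (sym (weightedSum-m0 b U V (suc n)))
  gridSum≡weightedSum zero    zero    (suc n) (suc m) b       n<b = trans (gridSum-00 (suc n) (suc m)) (sym (weightedSum-00 b (suc n) (suc m) n<b))
  gridSum≡weightedSum (suc U) V       (suc n) (suc m) b       n<b = begin
    gridSum (suc U) V (suc n) (suc m)
      ≡⟨ gridSum-stepU U V n (suc m) ⟩
    gridSum U V (suc n) (suc m) + gridSum (suc U) V n (suc m)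
      ≡⟨ cong₂ _+_ (gridSum≡weightedSum U V (suc n) (suc m) b n<b) (gridSum≡weightedSum (suc U) V n (suc m) b (<-trans (n<1+n n) n<b)) ⟩
    weightedSum b U V (suc n) (suc m) + weightedSum b (suc U) V n (suc m)
      ≡⟨ weightedSum-stepU b U V n (suc m) ⟨
    weightedSum b (suc U) V (suc n) (suc m)
      ∎
  gridSum≡weightedSum zero    (suc V) (suc n) (suc m) b       n<b = begin
    gridSum 0 (suc V) (suc n) (suc m)
      ≡⟨ gridSum-stepV 0 V (suc n) m ⟩
    gridSum 0 V (suc n) (suc m) + gridSum 0 (suc V) (suc n) m
      ≡⟨ cong₂ _+_ (gridSum≡weightedSum 0 V (suc n) (suc m) b n<b) (gridSum≡weightedSum 0 (suc V) (suc n) m b n<b) ⟩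
    weightedSum b 0 V (suc n) (suc m) + weightedSum b 0 (suc V) (suc n) m
      ≡⟨ weightedSum-stepV b 0 V (suc n) m ⟨
    weightedSum b 0 (suc V) (suc n) (suc m)
      ∎

module Moments where

  open import Data.Nat
  open import Data.Nat.Properties
  open import Data.Nat.Combinatorics
  open import Data.Nat.Tactic.RingSolver using (solve-∀)
  open import Relation.Nullary.Decidable using (yes; no)
  open import Algebra.Properties.CommutativeSemigroup +-commutativeSemigroup using (xy∙z≈y∙zx)
  open Sums
  open Binomial
  open Lattice using (weightedSum)
  open ≡-Reasoning

  -- C(a+b, a−t)·C(c+d, d−t), with complemented lower indices as in weightedSum;
  -- τ c d a b t = C(a+b, a+t)·C(c+d, d+t) is the same product at −t.
  τ : ℕ → ℕ → ℕ → ℕ → ℕ → ℕ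
  τ a b c d t = ((a + b) C (b + t)) * ((c + d) C (c + t))

  τ-vanishˡ : ∀ a b c d {t} → a < t → τ a b c d t ≡ 0
  τ-vanishˡ a b c d {t} a<t = cong (_* ((c + d) C (c + t))) (k>n⇒nCk≡0 (subst (_< b + t) (+-comm b a) (+-monoʳ-< b a<t)))

  τ-vanishʳ : ∀ a b c d {t} → d < t → τ a b c d t ≡ 0
  τ-vanishʳ a b c d {t} d<t = trans (cong (((a + b) C (b + t)) *_) (k>n⇒nCk≡0 (+-monoʳ-< c d<t))) (*-zeroʳ ((a + b) C (b + t)))

  τ-recurrence : ∀ a b c d t → (b + suc t) * (c + suc t) * τ a b c d (suc t) ≡ (a ∸ t) * (d ∸ t) * τ a b c d t
  τ-recurrence a b c d t = begin
    (b + suc t) * (c + suc t) * (x′ * y′)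
      ≡⟨ cong (λ k → k * (c + suc t) * (x′ * y′)) (+-suc b t) ⟩
    suc (b + t) * (c + suc t) * (x′ * y′)
      ≡⟨ cong (λ k → suc (b + t) * k * (x′ * y′)) (+-suc c t) ⟩
    suc (b + t) * suc (c + t) * (x′ * y′)
      ≡⟨ interchange (suc (b + t)) (suc (c + t)) x′ y′ ⟩
    (suc (b + t) * x′) * (suc (c + t) * y′)
      ≡⟨ cong₂ _*_ (C-ratio-shift a b t refl) (C-ratio-shift d c t (+-comm d c)) ⟩
    ((a ∸ t) * x) * ((d ∸ t) * y)
      ≡⟨ interchange (a ∸ t) x (d ∸ t) y ⟩
    (a ∸ t) * (d ∸ t) * (x * y)
      ∎
    where
    x = (a + b) C (b + t)
    y = (c + d) C (c + t)
    x′ = (a + b) C (b + suc t)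
    y′ = (c + d) C (c + suc t)
    interchange : ∀ a b c d → a * b * (c * d) ≡ (a * c) * (b * d)
    interchange = solve-∀

  weight-identity : ∀ {a b c d t} → a * d ≡ b * c → t ≤ a → t ≤ d →
                    (a + b + (c + d)) * t + (a ∸ t) * (d ∸ t) ≡ (b + t) * (c + t)
  weight-identity {a} {b} {c} {d} {t} ad≡bc t≤a t≤d =
    shifted (a ∸ t) (d ∸ t) (m+[n∸m]≡n t≤a) (m+[n∸m]≡n t≤d) ad≡bc
    where
    expand : ∀ t α δ b c → (t + α + b + (c + (t + δ))) * t + α * δ ≡ (t + α) * (t + δ) + (t * t + b * t + c * t)
    expand = solve-∀
    factor : ∀ t b c → b * c + (t * t + b * t + c * t) ≡ (b + t) * (c + t)
    factor = solve-∀
    shifted : ∀ α δ → t + α ≡ a → t + δ ≡ d → a * d ≡ b * c → (a + b + (c + d)) * t + (a ∸ t) * (d ∸ t) ≡ (b + t) * (c + t)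
    shifted α δ refl refl ad≡bc = begin
      (t + α + b + (c + (t + δ))) * t + (t + α ∸ t) * (t + δ ∸ t)
        ≡⟨ cong₂ (λ a d → (t + α + b + (c + (t + δ))) * t + a * d) (m+n∸m≡n t α) (m+n∸m≡n t δ) ⟩
      (t + α + b + (c + (t + δ))) * t + α * δ
        ≡⟨ expand t α δ b c ⟩
      (t + α) * (t + δ) + (t * t + b * t + c * t)
        ≡⟨ cong (_+ (t * t + b * t + c * t)) ad≡bc ⟩
      b * c + (t * t + b * t + c * t)
        ≡⟨ factor t b c ⟩
      (b + t) * (c + t)
        ∎

  *-cong-zeroʳ : ∀ x y {z} → z ≡ 0 → x * z ≡ y * z
  *-cong-zeroʳ x y refl = trans (*-zeroʳ x) (sym (*-zeroʳ y))

  τ-weight : ∀ a b c d → a * d ≡ b * c → ∀ t →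
             ((a + b + (c + d)) * t + (a ∸ t) * (d ∸ t)) * τ a b c d t ≡ (b + t) * (c + t) * τ a b c d t
  τ-weight a b c d ad≡bc t with t ≤? a | t ≤? d
  ... | yes t≤a | yes t≤d = cong (_* τ a b c d t) (weight-identity ad≡bc t≤a t≤d)
  ... | no t≰a  | _       = *-cong-zeroʳ ((a + b + (c + d)) * t + (a ∸ t) * (d ∸ t)) ((b + t) * (c + t)) (τ-vanishˡ a b c d (≰⇒> t≰a))
  ... | yes _   | no t≰d  = *-cong-zeroʳ ((a + b + (c + d)) * t + (a ∸ t) * (d ∸ t)) ((b + t) * (c + t)) (τ-vanishʳ a b c d (≰⇒> t≰d))

  τ-moment : ∀ a b c d → a * d ≡ b * c → ∀ {W} → a < W →
             (a + b + (c + d)) * ∑[ t < W ] (t * τ a b c d t) ≡ b * c * τ a b c d 0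
  τ-moment a b c d ad≡bc {W} a<W = begin
    S * ∑[ t < W ] (t * τ a b c d t)
      ≡⟨ ∑-distribˡ-* W S (λ t → t * τ a b c d t) ⟨
    ∑[ t < W ] (S * (t * τ a b c d t))
      ≡⟨ +-identityʳ _ ⟨
    ∑[ t < W ] (S * (t * τ a b c d t)) + 0
      ≡⟨ cong (∑[ t < W ] (S * (t * τ a b c d t)) +_) (trans (cong ((b + W) * (c + W) *_) (τ-vanishˡ a b c d a<W)) (*-zeroʳ ((b + W) * (c + W)))) ⟨
    ∑[ t < W ] (S * (t * τ a b c d t)) + Y W
      ≡⟨ ∑-telescope W (λ t → S * (t * τ a b c d t)) Y step ⟩
    (b + 0) * (c + 0) * τ a b c d 0
      ≡⟨ cong₂ (λ x y → x * y * τ a b c d 0) (+-identityʳ b) (+-identityʳ c) ⟩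
    b * c * τ a b c d 0
      ∎
    where
    S = a + b + (c + d)
    Y : ℕ → ℕ
    Y t = (b + t) * (c + t) * τ a b c d t
    step : ∀ t → S * (t * τ a b c d t) + Y (suc t) ≡ Y t
    step t = begin
      S * (t * τ a b c d t) + Y (suc t)
        ≡⟨ cong (S * (t * τ a b c d t) +_) (τ-recurrence a b c d t) ⟩
      S * (t * τ a b c d t) + (a ∸ t) * (d ∸ t) * τ a b c d t
        ≡⟨ cong (_+ (a ∸ t) * (d ∸ t) * τ a b c d t) (sym (*-assoc S t (τ a b c d t))) ⟩
      S * t * τ a b c d t + (a ∸ t) * (d ∸ t) * τ a b c d t
        ≡⟨ *-distribʳ-+ (τ a b c d t) (S * t) ((a ∸ t) * (d ∸ t)) ⟨
      (S * t + (a ∸ t) * (d ∸ t)) * τ a b c d t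
        ≡⟨ τ-weight a b c d ad≡bc t ⟩
      Y t
        ∎

  vandermonde-τ : ∀ a b c d {W} → a < W → c < W → (a + b + (c + d)) C (a + c) + τ c d a b 0 ≡ ∑ W (τ a b c d) + ∑ W (τ c d a b)
  vandermonde-τ a b c d {W} a<W c<W = begin
    (a + b + (c + d)) C (a + c) + τ c d a b 0
      ≡⟨ cong (_+ τ c d a b 0) (cong₂ _C_ (+-comm (a + b) (c + d)) (+-comm a c)) ⟩
    (c + d + (a + b)) C (c + a) + τ c d a b 0
      ≡⟨ cong (_+ τ c d a b 0) (vandermonde (c + d) (a + b) (c + a)) ⟨
    ∑ (suc (c + a)) f + τ c d a b 0
      ≡⟨ cong (λ k → ∑ k f + τ c d a b 0) (+-suc c a) ⟨
    ∑ (c + suc a) f + τ c d a b 0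
      ≡⟨ cong (_+ τ c d a b 0) (∑-split c (suc a) f) ⟩
    ∑ c f + ∑[ j < suc a ] f (c + j) + τ c d a b 0
      ≡⟨ cong₂ (λ x y → x + y + τ c d a b 0) lower upper ⟩
    ∑[ t < c ] τ c d a b (suc t) + ∑[ t < suc a ] τ a b c d t + τ c d a b 0
      ≡⟨ xy∙z≈y∙zx (∑[ t < c ] τ c d a b (suc t)) _ _ ⟩
    ∑[ t < suc a ] τ a b c d t + ∑[ t < suc c ] τ c d a b t
      ≡⟨ cong₂ _+_ (∑-vanishing-tail (τ a b c d) (λ t → τ-vanishˡ a b c d) a<W)
                   (∑-vanishing-tail (τ c d a b) (λ t → τ-vanishˡ c d a b) c<W) ⟨
    ∑ W (τ a b c d) + ∑ W (τ c d a b)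
      ∎
    where
    f : ℕ → ℕ
    f i = ((c + d) C i) * ((a + b) C (c + a ∸ i))
    upper : ∑[ j < suc a ] f (c + j) ≡ ∑[ t < suc a ] τ a b c d t
    upper = ∑-cong-< (suc a) (λ {j} j<1+a → begin
      ((c + d) C (c + j)) * ((a + b) C (c + a ∸ (c + j)))
        ≡⟨ cong (λ k → ((c + d) C (c + j)) * ((a + b) C k)) ([m+n]∸[m+o]≡n∸o c a j) ⟩
      ((c + d) C (c + j)) * ((a + b) C (a ∸ j))
        ≡⟨ cong (((c + d) C (c + j)) *_) (C-complement (a ∸ j) (b + j) (m∸n+[o+n]≡m+o b (≤-pred j<1+a))) ⟩
      ((c + d) C (c + j)) * ((a + b) C (b + j))
        ≡⟨ *-comm ((c + d) C (c + j)) _ ⟩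
      τ a b c d j
        ∎)
    lower : ∑ c f ≡ ∑[ t < c ] τ c d a b (suc t)
    lower = trans (∑-reverse c f) (∑-cong-< c (λ {t} t<c → cong₂ _*_
      (C-complement (c ∸ suc t) (d + suc t) (m∸n+[o+n]≡m+o d t<c))
      (cong ((a + b) C_) ([m+o]∸[m∸n]≡o+n a t<c))))

  weightedSum-τ : ∀ k b c r n m → weightedSum k (b + r) (c + r) n m ≡ ∑[ s < k ] (suc s * τ (r + suc n) b c (r + suc m) (r + suc s))
  weightedSum-τ k b c r n m = ∑-cong k (λ s → cong (suc s *_) (cong₂ _*_
    (cong₂ _C_ (rotate b r n) (+-assoc b r (suc s)))
    (cong₂ _C_ (+-assoc c r (suc m)) (+-assoc c r (suc s)))))
    where
    rotate : ∀ b r n → b + r + suc n ≡ r + suc n + b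
    rotate = solve-∀

  τ₀ : ∀ a b c d → τ a b c d 0 ≡ ((a + b) C a) * ((c + d) C c)
  τ₀ a b c d = cong₂ _*_ (trans (cong ((a + b) C_) (+-identityʳ b)) (sym (C-complement a b refl)))
                         (cong ((c + d) C_) (+-identityʳ c))

open import Data.Nat as ℕ using (ℕ; NonZero; zero; suc; z<s; s<s)
import Data.Nat.Properties as ℕ
import Data.Nat.Combinatorics as ℕ
import Data.Nat.Tactic.RingSolver as ℕ
open import Data.Integer using (ℤ; +_; -[1+_]; _+_; _-_; _*_; -_; ∣_∣)
import Data.Integer.Properties as ℤ
open import Data.Integer.Tactic.RingSolver using (solve-∀)
open import Relation.Nullary.Decidable using (yes; no)
open import Defs
open ≡-Reasoning
open Sums
open Binomial using (C-complement; m∸n+[o+n]≡m+o)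
open Lattice using (gridTerm; gridSum; weightedSum; gridTerm-split; gridSum≡weightedSum)
open Moments

[+m]-[+n]≡+[m∸n] : ∀ {m n} → n ℕ.≤ m → + m - + n ≡ + (m ℕ.∸ n)
[+m]-[+n]≡+[m∸n] {m} {n} n≤m = trans (ℤ.[+m]-[+n]≡m⊖n m n) (ℤ.⊖-≥ n≤m)

[+m]-[+n]≡-[n∸m] : ∀ {m n} → m ℕ.≤ n → + m - + n ≡ - + (n ℕ.∸ m)
[+m]-[+n]≡-[n∸m] {m} {n} m≤n = trans (ℤ.[+m]-[+n]≡m⊖n m n) (ℤ.⊖-≤ m≤n)

-[+m]+[+n]≡-[1+m∸1+n] : ∀ {m n} → n ℕ.< m → - + m + + n ≡ -[1+ (m ℕ.∸ suc n) ]
-[+m]+[+n]≡-[1+m∸1+n] {suc m} {n} n<m =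
  trans (ℤ.-m+n≡n⊖m (suc m) n) (trans (ℤ.⊖-< n<m) (cong (λ k → - + k) (ℕ.+-∸-assoc 1 (ℕ.≤-pred n<m))))

+*+*+≡+[*[*]] : ∀ x y z → + x * + y * + z ≡ + (x ℕ.* (y ℕ.* z))
+*+*+≡+[*[*]] x y z = begin
  + x * + y * + z            ≡⟨ cong (_* + z) (ℤ.pos-* x y) ⟨
  + (x ℕ.* y) * + z          ≡⟨ ℤ.pos-* (x ℕ.* y) z ⟨
  + (x ℕ.* y ℕ.* z)          ≡⟨ cong +_ (ℕ.*-assoc x y z) ⟩
  + (x ℕ.* (y ℕ.* z))        ∎

choose-complement : ∀ x y i {n} → x ℕ.+ y ≡ n → choose (+ n) (+ x - + i) ≡ choose (+ n) (+ (y ℕ.+ i))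
choose-complement x y i {n} x+y≡n with i ℕ.≤? x
... | yes i≤x = trans (cong (choose (+ n)) ([+m]-[+n]≡+[m∸n] i≤x))
                      (cong +_ (C-complement (x ℕ.∸ i) (y ℕ.+ i) (trans (m∸n+[o+n]≡m+o y i≤x) x+y≡n)))
... | no i≰x  = trans (cong (choose (+ n)) ([+m]-[+n]≡-[n∸m] (ℕ.<⇒≤ x<i)))
                      (trans (negative (ℕ.m<n⇒0<n∸m x<i))
                             (cong +_ (sym (ℕ.k>n⇒nCk≡0 (subst (ℕ._< y ℕ.+ i) (trans (ℕ.+-comm y x) x+y≡n) (ℕ.+-monoʳ-< y x<i))))))
  where
  x<i = ℕ.≰⇒> i≰x
  negative : ∀ {k} → 0 ℕ.< k → choose (+ n) (- + k) ≡ + 0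
  negative {suc k} _ = refl

Σ-unfold : ∀ lo hi {n} (f : ℤ → ℤ) → hi - lo + + 1 ≡ + n → Σ[ lo ⋯ hi ] f ≡ sumFrom lo n f
Σ-unfold lo hi f length rewrite length = refl

Σ-empty : ∀ lo hi k {f : ℤ → ℤ} → hi - lo + + 1 ≡ - + k → Σ[ lo ⋯ hi ] f ≡ + 0
Σ-empty lo hi zero    length rewrite length = refl
Σ-empty lo hi (suc k) length rewrite length = refl

sumFrom-split : ∀ lo m n (f : ℤ → ℤ) → sumFrom lo (m ℕ.+ n) f ≡ sumFrom lo m f + sumFrom (lo + + m) n f
sumFrom-split lo zero    n f = trans (cong (λ l → sumFrom l n f) (sym (ℤ.+-identityʳ lo))) (sym (ℤ.+-identityˡ _))
sumFrom-split lo (suc m) n f = begin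
  f lo + sumFrom (lo + + 1) (m ℕ.+ n) f
    ≡⟨ cong (_+_ (f lo)) (sumFrom-split (lo + + 1) m n f) ⟩
  f lo + (sumFrom (lo + + 1) m f + sumFrom (lo + + 1 + + m) n f)
    ≡⟨ ℤ.+-assoc (f lo) _ _ ⟨
  f lo + sumFrom (lo + + 1) m f + sumFrom (lo + + 1 + + m) n f
    ≡⟨ cong (λ l → f lo + sumFrom (lo + + 1) m f + sumFrom l n f) (ℤ.+-assoc lo (+ 1) (+ m)) ⟩
  f lo + sumFrom (lo + + 1) m f + sumFrom (lo + + suc m) n f
    ∎

sumFrom-cast : ∀ lo n {f : ℤ → ℤ} (g : ℕ → ℕ) → (∀ {i} → i ℕ.< n → f (lo + + i) ≡ + g i) → sumFrom lo n f ≡ + ∑ n g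
sumFrom-cast lo zero        g fg = refl
sumFrom-cast lo (suc n) {f} g fg = cong₂ _+_
  (trans (cong f (sym (ℤ.+-identityʳ lo))) (fg z<s))
  (sumFrom-cast (lo + + 1) n (λ i → g (suc i)) (λ {i} i<n → trans (cong f (ℤ.+-assoc lo (+ 1) (+ i))) (fg (s<s i<n))))

Σ-cast : ∀ lo hi n {f : ℤ → ℤ} (g : ℕ → ℕ) → hi - lo + + 1 ≡ + n → (∀ {i} → i ℕ.< n → f (lo + + i) ≡ + g i) →
         Σ[ lo ⋯ hi ] f ≡ + ∑ n g
Σ-cast lo hi n {f} g length fg = trans (Σ-unfold lo hi f length) (sumFrom-cast lo n g fg)

doubleSummand : ℤ → ℤ → ℤ → ℤ → ℤ → ℤ → ℤ → ℤ
doubleSummand A B C D r a b = choose (A + B - a + b - + 1) (A - r - a) * choose (C + D + a - b - + 1) (D - r - b)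

doubleSum : ℤ → ℤ → ℤ → ℤ → ℤ → ℤ
doubleSum A B C D r = Σ[ + 1 ⋯ A - r ] (λ a → Σ[ + 1 ⋯ D - r ] (doubleSummand A B C D r a))

data Excess (r : ℕ) : ℕ → Set where
  within : ∀ {a} → a ℕ.≤ r → Excess r a
  beyond : ∀ n → Excess r (r ℕ.+ suc n)

excess : ∀ r a → Excess r a
excess zero    zero    = within ℕ.z≤n
excess zero    (suc a) = beyond a
excess (suc r) zero    = within ℕ.z≤n
excess (suc r) (suc a) with excess r a
... | within a≤r = within (ℕ.s≤s a≤r)
... | beyond n   = beyond n

interval-length : ∀ r n → + (r ℕ.+ suc n) - + r - + 1 + + 1 ≡ + suc n
interval-length r n = cancel (+ r) (+ n)
  where
  cancel : ∀ r n → r + (+ 1 + n) - r - + 1 + + 1 ≡ + 1 + n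
  cancel = solve-∀

empty-interval : ∀ {a r} → a ℕ.≤ r → + a - + r - + 1 + + 1 ≡ - + (r ℕ.∸ a)
empty-interval {a} {r} a≤r = trans (cancel (+ a - + r)) ([+m]-[+n]≡-[n∸m] a≤r)
  where
  cancel : ∀ h → h - + 1 + + 1 ≡ h
  cancel = solve-∀

doubleSummand-grid : ∀ b c r {n m α β} → α ℕ.≤ n → β ℕ.≤ m →
  doubleSummand (+ (r ℕ.+ suc n)) (+ b) (+ c) (+ (r ℕ.+ suc m)) (+ r) (+ suc α) (+ suc β)
    ≡ + gridTerm (b ℕ.+ r) (c ℕ.+ r) n m (n ℕ.∸ α) (m ℕ.∸ β)
doubleSummand-grid b c r {n} {m} {α} {β} α≤n β≤m with n ℕ.∸ α | m ℕ.∸ β | ℕ.m+[n∸m]≡n α≤n | ℕ.m+[n∸m]≡n β≤m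
... | i | j | refl | refl = begin
  choose (+ (r ℕ.+ suc (α ℕ.+ i)) + + b - + suc α + + suc β - + 1) (+ (r ℕ.+ suc (α ℕ.+ i)) - + r - + suc α)
    * choose (+ c + + (r ℕ.+ suc (β ℕ.+ j)) + + suc α - + suc β - + 1) (+ (r ℕ.+ suc (β ℕ.+ j)) - + r - + suc β)
    ≡⟨ cong₂ _*_ (cong₂ choose (top₁ (+ r) (+ α) (+ i) (+ b) (+ β)) (bottom (+ r) (+ α) (+ i)))
                 (cong₂ choose (top₂ (+ c) (+ r) (+ α) (+ β) (+ j)) (bottom (+ r) (+ β) (+ j))) ⟩
  + ((b ℕ.+ r ℕ.+ i ℕ.+ β) ℕ.C i) * + ((c ℕ.+ r ℕ.+ α ℕ.+ j) ℕ.C j)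
    ≡⟨ ℤ.pos-* ((b ℕ.+ r ℕ.+ i ℕ.+ β) ℕ.C i) ((c ℕ.+ r ℕ.+ α ℕ.+ j) ℕ.C j) ⟨
  + (((b ℕ.+ r ℕ.+ i ℕ.+ β) ℕ.C i) ℕ.* ((c ℕ.+ r ℕ.+ α ℕ.+ j) ℕ.C j))
    ≡⟨ cong +_ (gridTerm-split (b ℕ.+ r) (c ℕ.+ r) α i β j) ⟨
  + gridTerm (b ℕ.+ r) (c ℕ.+ r) (α ℕ.+ i) (β ℕ.+ j) i j
    ∎
  where
  top₁ : ∀ r α i b β → r + (+ 1 + (α + i)) + b - (+ 1 + α) + (+ 1 + β) - + 1 ≡ b + r + i + β
  top₁ = solve-∀
  top₂ : ∀ c r α β j → c + (r + (+ 1 + (β + j))) + (+ 1 + α) - (+ 1 + β) - + 1 ≡ c + r + α + j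
  top₂ = solve-∀
  bottom : ∀ r α i → r + (+ 1 + (α + i)) - r - (+ 1 + α) ≡ i
  bottom = solve-∀

doubleSum-grid : ∀ b c r n m → doubleSum (+ (r ℕ.+ suc n)) (+ b) (+ c) (+ (r ℕ.+ suc m)) (+ r) ≡ + gridSum (b ℕ.+ r) (c ℕ.+ r) n m
doubleSum-grid b c r n m = begin
  doubleSum (+ (r ℕ.+ suc n)) (+ b) (+ c) (+ (r ℕ.+ suc m)) (+ r)
    ≡⟨ Σ-cast (+ 1) (+ (r ℕ.+ suc n) - + r) (suc n) (λ α → ∑[ β < suc m ] g (n ℕ.∸ α) (m ℕ.∸ β)) (interval-length r n)
              (λ {α} α<1+n →
         Σ-cast (+ 1) (+ (r ℕ.+ suc m) - + r) (suc m)
                (λ β → g (n ℕ.∸ α) (m ℕ.∸ β)) (interval-length r m) (λ β<1+m →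
           doubleSummand-grid b c r (ℕ.≤-pred α<1+n) (ℕ.≤-pred β<1+m))) ⟩
  + ∑[ α < suc n ] ∑[ β < suc m ] g (n ℕ.∸ α) (m ℕ.∸ β)
    ≡⟨ cong +_ (∑-cong (suc n) (λ α → ∑-reverse (suc m) (g (n ℕ.∸ α)))) ⟨
  + ∑[ α < suc n ] ∑[ j < suc m ] g (n ℕ.∸ α) j
    ≡⟨ cong +_ (∑-reverse (suc n) (λ i → ∑ (suc m) (g i))) ⟨
  + gridSum (b ℕ.+ r) (c ℕ.+ r) n m
    ∎
  where
  g : ℕ → ℕ → ℕ
  g = gridTerm (b ℕ.+ r) (c ℕ.+ r) n m

doubleSum-τ : ∀ a b c d r {k} → a ℕ.≤ k → doubleSum (+ a) (+ b) (+ c) (+ d) (+ r) ≡ + ∑[ s < k ] (suc s ℕ.* τ a b c d (r ℕ.+ suc s))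
doubleSum-τ a b c d r {k} a≤k with excess r a | excess r d
... | within a≤r | _ = begin
  doubleSum (+ a) (+ b) (+ c) (+ d) (+ r)
    ≡⟨ Σ-empty (+ 1) (+ a - + r) (r ℕ.∸ a) (empty-interval a≤r) ⟩
  + 0
    ≡⟨ cong +_ (∑-zeroʳ k suc (λ s → τ a b c d (r ℕ.+ suc s)) (λ s → τ-vanishˡ a b c d (ℕ.≤-<-trans a≤r (ℕ.m<m+n r z<s)))) ⟨
  + ∑[ s < k ] (suc s ℕ.* τ a b c d (r ℕ.+ suc s))
    ∎
... | beyond n | within d≤r = begin
  doubleSum (+ (r ℕ.+ suc n)) (+ b) (+ c) (+ d) (+ r)
    ≡⟨ Σ-cast (+ 1) (+ (r ℕ.+ suc n) - + r) (suc n) (λ _ → 0) (interval-length r n)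
              (λ _ → Σ-empty (+ 1) (+ d - + r) (r ℕ.∸ d) (empty-interval d≤r)) ⟩
  + ∑[ α < suc n ] 0
    ≡⟨ cong +_ (∑-zero (suc n) (λ _ → refl)) ⟩
  + 0
    ≡⟨ cong +_ (∑-zeroʳ k suc (λ s → τ (r ℕ.+ suc n) b c d (r ℕ.+ suc s))
                         (λ s → τ-vanishʳ (r ℕ.+ suc n) b c d (ℕ.≤-<-trans d≤r (ℕ.m<m+n r z<s)))) ⟨
  + ∑[ s < k ] (suc s ℕ.* τ (r ℕ.+ suc n) b c d (r ℕ.+ suc s))
    ∎
... | beyond n | beyond m = begin
  doubleSum (+ (r ℕ.+ suc n)) (+ b) (+ c) (+ (r ℕ.+ suc m)) (+ r)
    ≡⟨ doubleSum-grid b c r n m ⟩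
  + gridSum (b ℕ.+ r) (c ℕ.+ r) n m
    ≡⟨ cong +_ (gridSum≡weightedSum (b ℕ.+ r) (c ℕ.+ r) n m k (ℕ.<-≤-trans (ℕ.n<1+n n) (ℕ.≤-trans (ℕ.m≤n+m (suc n) r) a≤k))) ⟩
  + weightedSum k (b ℕ.+ r) (c ℕ.+ r) n m
    ≡⟨ cong +_ (weightedSum-τ k b c r n m) ⟩
  + ∑[ s < k ] (suc s ℕ.* τ (r ℕ.+ suc n) b c (r ℕ.+ suc m) (r ℕ.+ suc s))
    ∎

kSummand : ℤ → ℤ → ℤ → ℤ → ℕ → ℤ → ℤ
kSummand A B C D r k = (+ r - + ∣ k ∣) * choose (A + B) (A - k) * choose (C + D) (D - k)

kSum : ℤ → ℤ → ℤ → ℤ → ℕ → ℤ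
kSum A B C D r = Σ[ + 1 - + r ⋯ + r - + 1 ] (kSummand A B C D r)

kSummand-nonnegative : ∀ a b c d {r t} → t ℕ.≤ r → kSummand (+ a) (+ b) (+ c) (+ d) r (+ t) ≡ + ((r ℕ.∸ t) ℕ.* τ a b c d t)
kSummand-nonnegative a b c d {r} {t} t≤r = begin
  (+ r - + t) * choose (+ (a ℕ.+ b)) (+ a - + t) * choose (+ (c ℕ.+ d)) (+ d - + t)
    ≡⟨ cong₂ _*_ (cong₂ _*_ ([+m]-[+n]≡+[m∸n] t≤r) (choose-complement a b t refl)) (choose-complement d c t (ℕ.+-comm d c)) ⟩
  + (r ℕ.∸ t) * + ((a ℕ.+ b) ℕ.C (b ℕ.+ t)) * + ((c ℕ.+ d) ℕ.C (c ℕ.+ t))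
    ≡⟨ +*+*+≡+[*[*]] (r ℕ.∸ t) _ _ ⟩
  + ((r ℕ.∸ t) ℕ.* τ a b c d t)
    ∎

kSummand-negative : ∀ a b c d {r j} → suc j ℕ.≤ r → kSummand (+ a) (+ b) (+ c) (+ d) r -[1+ j ] ≡ + ((r ℕ.∸ suc j) ℕ.* τ c d a b (suc j))
kSummand-negative a b c d {r} {j} j<r = begin
  (+ r - + suc j) * + ((a ℕ.+ b) ℕ.C (a ℕ.+ suc j)) * + ((c ℕ.+ d) ℕ.C (d ℕ.+ suc j))
    ≡⟨ cong (λ x → x * + ((a ℕ.+ b) ℕ.C (a ℕ.+ suc j)) * + ((c ℕ.+ d) ℕ.C (d ℕ.+ suc j))) ([+m]-[+n]≡+[m∸n] j<r) ⟩
  + (r ℕ.∸ suc j) * + ((a ℕ.+ b) ℕ.C (a ℕ.+ suc j)) * + ((c ℕ.+ d) ℕ.C (d ℕ.+ suc j))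
    ≡⟨ +*+*+≡+[*[*]] (r ℕ.∸ suc j) _ _ ⟩
  + ((r ℕ.∸ suc j) ℕ.* (((a ℕ.+ b) ℕ.C (a ℕ.+ suc j)) ℕ.* ((c ℕ.+ d) ℕ.C (d ℕ.+ suc j))))
    ≡⟨ cong (λ x → + ((r ℕ.∸ suc j) ℕ.* x)) (ℕ.*-comm ((a ℕ.+ b) ℕ.C (a ℕ.+ suc j)) ((c ℕ.+ d) ℕ.C (d ℕ.+ suc j))) ⟩
  + ((r ℕ.∸ suc j) ℕ.* τ c d a b (suc j))
    ∎

kSum-τ : ∀ a b c d r → kSum (+ a) (+ b) (+ c) (+ d) r + + (r ℕ.* τ c d a b 0)
                       ≡ + (∑[ t < r ] ((r ℕ.∸ t) ℕ.* τ a b c d t) ℕ.+ ∑[ t < r ] ((r ℕ.∸ t) ℕ.* τ c d a b t))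
kSum-τ a b c d zero    = refl
kSum-τ a b c d (suc r) = begin
  kSum (+ a) (+ b) (+ c) (+ d) (suc r) + + (suc r ℕ.* τ c d a b 0)
    ≡⟨ cong (_+ + (suc r ℕ.* τ c d a b 0)) split ⟩
  + (∑ r g⁻ ℕ.+ ∑ (suc r) g⁺ ℕ.+ suc r ℕ.* τ c d a b 0)
    ≡⟨ cong +_ (xy∙z≈y∙zx (∑ r g⁻) (∑ (suc r) g⁺) _) ⟩
  + (∑ (suc r) g⁺ ℕ.+ (suc r ℕ.* τ c d a b 0 ℕ.+ ∑ r g⁻))
    ∎
  where
  open import Algebra.Properties.CommutativeSemigroup ℕ.+-commutativeSemigroup using (xy∙z≈y∙zx)
  h = kSummand (+ a) (+ b) (+ c) (+ d) (suc r)
  g⁺ g⁻ : ℕ → ℕ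
  g⁺ t = (suc r ℕ.∸ t) ℕ.* τ a b c d t
  g⁻ t = (suc r ℕ.∸ suc t) ℕ.* τ c d a b (suc t)
  length : ∀ r → (+ 1 + r) - + 1 - (+ 1 - (+ 1 + r)) + + 1 ≡ r + (+ 1 + r)
  length = solve-∀
  lower : ∀ r → + 1 - (+ 1 + r) ≡ - r
  lower = solve-∀
  middle : ∀ r → + 1 - (+ 1 + r) + r ≡ + 0
  middle = solve-∀
  split : kSum (+ a) (+ b) (+ c) (+ d) (suc r) ≡ + (∑ r g⁻ ℕ.+ ∑ (suc r) g⁺)
  split = begin
    Σ[ + 1 - + suc r ⋯ + suc r - + 1 ] h
      ≡⟨ Σ-unfold (+ 1 - + suc r) (+ suc r - + 1) h (length (+ r)) ⟩
    sumFrom (+ 1 - + suc r) (r ℕ.+ suc r) h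
      ≡⟨ sumFrom-split (+ 1 - + suc r) r (suc r) h ⟩
    sumFrom (+ 1 - + suc r) r h + sumFrom (+ 1 - + suc r + + r) (suc r) h
      ≡⟨ cong₂ (λ l l′ → sumFrom l r h + sumFrom l′ (suc r) h) (lower (+ r)) (middle (+ r)) ⟩
    sumFrom (- + r) r h + sumFrom (+ 0) (suc r) h
      ≡⟨ cong₂ _+_ (sumFrom-cast (- + r) r {h} (λ i → g⁻ (r ℕ.∸ suc i))
                      (λ {i} i<r → trans (cong h (-[+m]+[+n]≡-[1+m∸1+n] i<r)) (kSummand-negative a b c d (ℕ.s≤s (ℕ.m∸n≤m r (suc i))))))
                   (sumFrom-cast (+ 0) (suc r) {h} g⁺ (λ t<1+r → kSummand-nonnegative a b c d (ℕ.<⇒≤ t<1+r))) ⟩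
    + ∑[ i < r ] g⁻ (r ℕ.∸ suc i) + + ∑ (suc r) g⁺
      ≡⟨ cong (λ x → + x + + ∑ (suc r) g⁺) (∑-reverse r g⁻) ⟨
    + (∑ r g⁻ ℕ.+ ∑ (suc r) g⁺)
      ∎

assemble : ∀ s r y x₁ x₂ v t₀ ks p⁺ z⁺ m⁺ k⁺ p⁻ z⁻ m⁻ k⁻ →
  p⁺ ℕ.+ r ℕ.* z⁺ ≡ m⁺ ℕ.+ k⁺ → p⁻ ℕ.+ r ℕ.* z⁻ ≡ m⁻ ℕ.+ k⁻ →
  s ℕ.* m⁺ ≡ y ℕ.* (x₁ ℕ.* x₂) → s ℕ.* m⁻ ≡ y ℕ.* (x₁ ℕ.* x₂) →
  v ℕ.+ t₀ ≡ z⁺ ℕ.+ z⁻ → ks + + (r ℕ.* t₀) ≡ + (k⁺ ℕ.+ k⁻) →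
  + s * (+ p⁺ + + p⁻) ≡ + 2 * + y * + x₁ * + x₂ + + s * ((+ 0 - + r * + v) + ks)
assemble s r y x₁ x₂ v t₀ ks p⁺ z⁺ m⁺ k⁺ p⁻ z⁻ m⁻ k⁻ shift⁺ shift⁻ moment⁺ moment⁻ vandermonde kSum′ = begin
  + s * (+ p⁺ + + p⁻)
    ≡⟨ cong (λ u → + s * u) (cong₂ _+_ (isolate p⁺ z⁺ m⁺ k⁺ shift⁺) (isolate p⁻ z⁻ m⁻ k⁻ shift⁻)) ⟩
  + s * ((+ m⁺ + + k⁺ - + r * + z⁺) + (+ m⁻ + + k⁻ - + r * + z⁻))
    ≡⟨ regroup (+ s) (+ m⁺) (+ m⁻) (+ k⁺) (+ k⁻) (+ r) (+ z⁺) (+ z⁻) ⟩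
  + s * + m⁺ + + s * + m⁻ + + s * ((+ k⁺ + + k⁻) - + r * (+ z⁺ + + z⁻))
    ≡⟨ cong₂ (λ u w → u + w + + s * ((+ k⁺ + + k⁻) - + r * (+ z⁺ + + z⁻))) (moment moment⁺) (moment moment⁻) ⟩
  + y * (+ x₁ * + x₂) + + y * (+ x₁ * + x₂) + + s * ((+ k⁺ + + k⁻) - + r * (+ z⁺ + + z⁻))
    ≡⟨ cong₂ (λ u w → + y * (+ x₁ * + x₂) + + y * (+ x₁ * + x₂) + + s * (u - + r * w)) kSum″ (cong +_ vandermonde) ⟨
  + y * (+ x₁ * + x₂) + + y * (+ x₁ * + x₂) + + s * ((ks + + r * + t₀) - + r * (+ v + + t₀))
    ≡⟨ collect (+ s) (+ y) (+ x₁) (+ x₂) ks (+ r) (+ v) (+ t₀) ⟩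
  + 2 * + y * + x₁ * + x₂ + + s * ((+ 0 - + r * + v) + ks)
    ∎
  where
  moment : ∀ {m} → s ℕ.* m ≡ y ℕ.* (x₁ ℕ.* x₂) → + s * + m ≡ + y * (+ x₁ * + x₂)
  moment {m} eq = trans (sym (ℤ.pos-* s m)) (trans (cong +_ eq) (trans (ℤ.pos-* y (x₁ ℕ.* x₂)) (cong (+ y *_) (ℤ.pos-* x₁ x₂))))
  kSum″ : ks + + r * + t₀ ≡ + k⁺ + + k⁻
  kSum″ = trans (cong (_+_ ks) (sym (ℤ.pos-* r t₀))) kSum′
  isolate : ∀ p z m k → p ℕ.+ r ℕ.* z ≡ m ℕ.+ k → + p ≡ + m + + k - + r * + z
  isolate p z m k eq = begin
    + p                               ≡⟨ add-sub (+ p) (+ r * + z) ⟩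
    + p + + r * + z - + r * + z       ≡⟨ cong (λ u → + p + u - + r * + z) (ℤ.pos-* r z) ⟨
    + (p ℕ.+ r ℕ.* z) - + r * + z     ≡⟨ cong (λ u → + u - + r * + z) eq ⟩
    + m + + k - + r * + z             ∎
    where
    add-sub : ∀ x y → x ≡ x + y - y
    add-sub = solve-∀
  regroup : ∀ s m⁺ m⁻ k⁺ k⁻ r z⁺ z⁻ →
    s * ((m⁺ + k⁺ - r * z⁺) + (m⁻ + k⁻ - r * z⁻)) ≡ s * m⁺ + s * m⁻ + s * ((k⁺ + k⁻) - r * (z⁺ + z⁻))
  regroup = solve-∀
  collect : ∀ s y x₁ x₂ ks r v t₀ →
    y * (x₁ * x₂) + y * (x₁ * x₂) + s * ((ks + r * t₀) - r * (v + t₀)) ≡ + 2 * y * x₁ * x₂ + s * ((+ 0 - r * v) + ks)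
  collect = solve-∀

-- The theorem with pm, qm, pn, qn, (p+q)(m+n) and 2pqmn abstracted to A, B, C, D, S and c.
Identity : ℤ → ℤ → ℤ → ℤ → ℤ → ℤ → ℕ → Set
Identity A B C D S c r =
  S * (doubleSum A B C D (+ r) + doubleSum C D A B (+ r))
    ≡ c * choose (A + B) A * choose (C + D) C + S * ((+ 0 - + r * choose S (A + C)) + kSum A B C D r)

Identity-cong : ∀ {A A′ B B′ C C′ D D′ S S′ c c′ r} → A ≡ A′ → B ≡ B′ → C ≡ C′ → D ≡ D′ → S ≡ S′ → c ≡ c′ →
                Identity A B C D S c r → Identity A′ B′ C′ D′ S′ c′ r
Identity-cong refl refl refl refl refl refl holds = holds

identity : ∀ a b c d r → a ℕ.* d ≡ b ℕ.* c → Identity (+ a) (+ b) (+ c) (+ d) (+ (a ℕ.+ b ℕ.+ (c ℕ.+ d))) (+ 2 * + (a ℕ.* d)) r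
identity a b c d r ad≡bc = begin
  + S * (doubleSum (+ a) (+ b) (+ c) (+ d) (+ r) + doubleSum (+ c) (+ d) (+ a) (+ b) (+ r))
    ≡⟨ cong₂ (λ x y → + S * (x + y)) (doubleSum-τ a b c d r (ℕ.m≤m+n a c)) (doubleSum-τ c d a b r (ℕ.m≤n+m c a)) ⟩
  + S * (+ P⁺ + + P⁻)
    ≡⟨ assemble S r (a ℕ.* d) ((a ℕ.+ b) ℕ.C a) ((c ℕ.+ d) ℕ.C c) (S ℕ.C (a ℕ.+ c)) (τ c d a b 0) (kSum (+ a) (+ b) (+ c) (+ d) r)
                P⁺ (∑ W (τ a b c d)) (moment (τ a b c d)) (tail (τ a b c d)) P⁻ (∑ W (τ c d a b)) (moment (τ c d a b)) (tail (τ c d a b))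
                (∑-tail-moment r k (τ a b c d)) (∑-tail-moment r k (τ c d a b)) moment⁺ moment⁻
                (vandermonde-τ a b c d a<W c<W) (kSum-τ a b c d r) ⟩
  + 2 * + (a ℕ.* d) * + ((a ℕ.+ b) ℕ.C a) * + ((c ℕ.+ d) ℕ.C c) + + S * ((+ 0 - + r * + (S ℕ.C (a ℕ.+ c))) + kSum (+ a) (+ b) (+ c) (+ d) r)
    ∎
  where
  S = a ℕ.+ b ℕ.+ (c ℕ.+ d)
  central = ((a ℕ.+ b) ℕ.C a) ℕ.* ((c ℕ.+ d) ℕ.C c)
  k = a ℕ.+ c
  W = r ℕ.+ suc k
  P⁺ = ∑[ s < k ] (suc s ℕ.* τ a b c d (r ℕ.+ suc s))
  P⁻ = ∑[ s < k ] (suc s ℕ.* τ c d a b (r ℕ.+ suc s))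
  moment tail : (ℕ → ℕ) → ℕ
  moment T = ∑[ t < W ] (t ℕ.* T t)
  tail T = ∑[ t < r ] ((r ℕ.∸ t) ℕ.* T t)
  a<W : a ℕ.< W
  a<W = ℕ.≤-trans (ℕ.s≤s (ℕ.m≤m+n a c)) (ℕ.m≤n+m (suc k) r)
  c<W : c ℕ.< W
  c<W = ℕ.≤-trans (ℕ.s≤s (ℕ.m≤n+m c a)) (ℕ.m≤n+m (suc k) r)
  moment⁺ : S ℕ.* moment (τ a b c d) ≡ a ℕ.* d ℕ.* central
  moment⁺ = trans (τ-moment a b c d ad≡bc a<W) (cong₂ ℕ._*_ (sym ad≡bc) (τ₀ a b c d))
  moment⁻ : S ℕ.* moment (τ c d a b) ≡ a ℕ.* d ℕ.* central
  moment⁻ = trans (cong (ℕ._* moment (τ c d a b)) (ℕ.+-comm (a ℕ.+ b) (c ℕ.+ d)))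
                  (trans (τ-moment c d a b cb≡da c<W) (cong₂ ℕ._*_ (ℕ.*-comm d a) (trans (τ₀ c d a b) (ℕ.*-comm ((c ℕ.+ d) ℕ.C c) _))))
    where
    cb≡da : c ℕ.* b ≡ d ℕ.* a
    cb≡da = trans (ℕ.*-comm c b) (trans (sym ad≡bc) (ℕ.*-comm a d))

mainTheorem6 : (m n p q r : ℕ) → .{{NonZero m}} → .{{NonZero n}} → .{{NonZero p}} → .{{NonZero q}} → .{{NonZero r}} →
    ((+ p) + (+ q)) * ((+ m) + (+ n)) *
      ( Σ[ + 1 ⋯ (+ p) * (+ m) - (+ r) ] (λ a → Σ[ + 1 ⋯ (+ q) * (+ n) - (+ r) ] (λ b →
          choose ((+ p) * (+ m) + (+ q) * (+ m) - a + b - + 1) ((+ p) * (+ m) - (+ r) - a)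
            * choose ((+ p) * (+ n) + (+ q) * (+ n) + a - b - + 1) ((+ q) * (+ n) - (+ r) - b)))
      + Σ[ + 1 ⋯ (+ p) * (+ n) - (+ r) ] (λ a → Σ[ + 1 ⋯ (+ q) * (+ m) - (+ r) ] (λ b →
          choose ((+ p) * (+ n) + (+ q) * (+ n) - a + b - + 1) ((+ p) * (+ n) - (+ r) - a)
            * choose ((+ p) * (+ m) + (+ q) * (+ m) + a - b - + 1) ((+ q) * (+ m) - (+ r) - b))) )
    ≡ + 2 * (+ p) * (+ q) * (+ m) * (+ n) * choose ((+ p) * (+ m) + (+ q) * (+ m)) ((+ p) * (+ m)) * choose ((+ p) * (+ n) + (+ q) * (+ n)) ((+ p) * (+ n))
      + ((+ p) + (+ q)) * ((+ m) + (+ n)) *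
        ( (+ 0 - (+ r) * choose (((+ p) + (+ q)) * ((+ m) + (+ n))) ((+ p) * (+ m) + (+ p) * (+ n)))
        + Σ[ + 1 - (+ r) ⋯ (+ r) - + 1 ] (λ k →
            ((+ r) - + ∣ k ∣) * choose ((+ p) * (+ m) + (+ q) * (+ m)) ((+ p) * (+ m) - k) * choose ((+ p) * (+ n) + (+ q) * (+ n)) ((+ q) * (+ n) - k)) )
mainTheorem6 m n p q r =
  Identity-cong (ℤ.pos-* p m) (ℤ.pos-* q m) (ℤ.pos-* p n) (ℤ.pos-* q n) total coefficient
    (identity (p ℕ.* m) (q ℕ.* m) (p ℕ.* n) (q ℕ.* n) r (proportional p q m n))
  where
  proportional : ∀ p q m n → p ℕ.* m ℕ.* (q ℕ.* n) ≡ q ℕ.* m ℕ.* (p ℕ.* n)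
  proportional = ℕ.solve-∀
  expand : ∀ p q m n → p ℕ.* m ℕ.+ q ℕ.* m ℕ.+ (p ℕ.* n ℕ.+ q ℕ.* n) ≡ (p ℕ.+ q) ℕ.* (m ℕ.+ n)
  expand = ℕ.solve-∀
  reorder : ∀ p q m n → + 2 * (p * m * (q * n)) ≡ + 2 * p * q * m * n
  reorder = solve-∀
  total : + (p ℕ.* m ℕ.+ q ℕ.* m ℕ.+ (p ℕ.* n ℕ.+ q ℕ.* n)) ≡ (+ p + + q) * (+ m + + n)
  total = trans (cong +_ (expand p q m n)) (ℤ.pos-* (p ℕ.+ q) (m ℕ.+ n))
  coefficient : + 2 * + (p ℕ.* m ℕ.* (q ℕ.* n)) ≡ + 2 * + p * + q * + m * + n
  coefficient = trans (cong (+ 2 *_) (trans (ℤ.pos-* (p ℕ.* m) (q ℕ.* n)) (cong₂ _*_ (ℤ.pos-* p m) (ℤ.pos-* q n))))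
                      (reorder (+ p) (+ q) (+ m) (+ n))
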